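{- Let $D$ be a finite set with $|D|\ge2$. Then ${\cal C}_D$ strictly implements every predicate in ${\cal U}_D$.
   Context: For $\emptyset\ne D'\subseteq D$, $u_{D'}$ is the unary predicate on $D$ with $u_{D'}(x)=1$ iff $x\in D'$; ${\cal U}_D=\{u_{D'}:\emptyset\ne D'\subseteq D\}$ and ${\cal C}_D=\{u_{\{d\}}:d\in D\}$. A predicate is a function $D^m\to\{0,1\}$. Strict implementation: let $Y=\{y_1,\dots,y_m\}$ (primary) and $Z=\{z_1,\dots,z_n\}$ (auxiliary, possibly empty) be disjoint sets of variables and let $g_1(\mathbf{y}_1),\dots,g_s(\mathbf{y}_s)$, $s>0$, be constraints over $Y\cup Z$ (each $g_i$ a predicate applied to a tuple $\mathbf{y}_i$ of variables). If $g$ is an $m$-ary predicate such that $g(y_1,\dots,y_m)+(\alpha-1)=\max_{Z}\sum_{i=1}^s g_i(\mathbf{y}_i)$ for all values of $y_1,\dots,y_m$ in $D$ and some fixed nonnegative integer $\alpha$ (the maximum being over all assignments of values in $D$ to the variables of $Z$), this is a strict $\alpha$-implementation of $g$ from $g_1,\dots,g_s$. A set ${\cal F}$ strictly implements $g$ if for some $\alpha$ there is a strict $\alpha$-implementation of $g$ using predicates only from ${\cal F}$. -}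

module Defs where

open import Data.Nat using (ℕ; zero; suc; _+_; _≤_)
open import Data.Fin using (Fin)
open import Data.Fin.Subset using (Subset; Nonempty)
open import Data.Vec using (lookup)
open import Data.Sum using (_⊎_; inj₁; inj₂)
open import Data.Product using (Σ; ∃; ∃-syntax; _×_; _,_)
open import Data.List using (List; []; _∷_; map)
open import Data.Nat.ListAction using (sum)
open import Data.Bool using (Bool; true; false; if_then_else_)
open import Relation.Binary.PropositionalEquality using (_≡_)

-- The domain D is modelled as Fin k (every finite set is in bijection with some Fin k).
-- An m-ary predicate on D is a function D^m → {0,1}; values are taken in ℕ
-- (0/1-valuedness is stated separately where needed).
Predicate : ℕ → ℕ → Set
Predicate k m = (Fin m → Fin k) → ℕ

IsPredicate : ∀ {k m} → Predicate k m → Set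
IsPredicate f = ∀ x → (f x ≡ 0) ⊎ (f x ≡ 1)

PredSet : ℕ → Set₁
PredSet k = ∀ m → Predicate k m → Set

u : ∀ {k} → Subset k → Predicate k 1
u D' x = if lookup D' (x Fin.zero) then 1 else 0
  where import Data.Fin as Fin

-- 𝒰_D : all u_{D'} with D' nonempty (membership as the unary predicate u_{D'} itself)
𝒰 : (k : ℕ) → Subset k → Set
𝒰 k D' = Nonempty D'

data 𝒞 (k : ℕ) : PredSet k where
  const : (d : Fin k) (g : Predicate k 1) →
          (∀ x → g x ≡ u (Data.Fin.Subset.⁅ d ⁆) x) → 𝒞 k 1 g

-- A constraint over variables Y ∪ Z (|Y| = m primary, |Z| = n auxiliary),
-- using a predicate from 𝓕: arity r, predicate, membership proof,
-- and the tuple of variables it is applied to.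
record Constraint {k : ℕ} (𝓕 : PredSet k) (m n : ℕ) : Set where
  field
    arity : ℕ
    pred  : Predicate k arity
    inF   : 𝓕 arity pred
    args  : Fin arity → Fin m ⊎ Fin n

evalC : ∀ {k} {𝓕 : PredSet k} {m n} → Constraint 𝓕 m n →
        (Fin m → Fin k) → (Fin n → Fin k) → ℕ
evalC c y z = Constraint.pred c (λ i → [ y , z ]′ (Constraint.args c i))
  where open import Data.Sum using ([_,_]′)

total : ∀ {k} {𝓕 : PredSet k} {m n} → List (Constraint 𝓕 m n) →
        (Fin m → Fin k) → (Fin n → Fin k) → ℕ
total cs y z = sum (map (λ c → evalC c y z) cs)

IsMax : ∀ {A : Set} → (A → ℕ) → ℕ → Set
IsMax {A} f v = (∃[ a ] f a ≡ v) × (∀ a → f a ≤ v)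

-- Strict α-implementation of g (m-ary) from the constraints cs (s > 0) over
-- n auxiliary variables:  g(y) + (α - 1) = max_Z Σ g_i.
-- Since α is a natural number and α - 1 could be -1, we state it as
-- g(y) + α = max_Z Σ g_i + 1.
StrictImpl : ∀ {k} (𝓕 : PredSet k) {m} (g : Predicate k m) (α : ℕ) → Set
StrictImpl {k} 𝓕 {m} g α =
  ∃[ n ] Σ (List (Constraint 𝓕 m n)) λ cs →
    (cs ≢[] ) × (∀ y → ∃[ v ] (IsMax (total cs y) v × (g y + α ≡ v + 1)))
  where
    _≢[] : ∀ {A : Set} → List A → Set
    [] ≢[] = Data.Empty.⊥ where import Data.Empty
    (_ ∷ _) ≢[] = Data.Unit.⊤ where import Data.Unit

StrictlyImplements : ∀ {k} (𝓕 : PredSet k) {m} (g : Predicate k m) → Set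
StrictlyImplements 𝓕 g = ∃[ α ] StrictImpl 𝓕 g α

{-# OPTIONS --safe #-}
-- For y ∈ D, u_{D'}(y) = Σ_{d ∈ D'} u_{{d}}(y), since exactly the summand with d = y can be
-- nonzero. So the constraints u_{{d}}(y₁), d ∈ D', with no auxiliary variables, strictly
-- 1-implement u_{D'}; nonemptiness of D' is what makes this list of constraints nonempty.
module Submission where

open import Defs
open import Data.Nat using (ℕ; _≤_; zero; suc; _+_)
open import Data.Nat.Properties using (≤-reflexive)
open import Data.Nat.ListAction using (sum)
open import Data.Fin using (Fin; zero; suc)
open import Data.Fin.Subset using (Subset; ⁅_⁆)
open import Data.Vec using ([]; _∷_; lookup)
open import Data.Vec.Properties using ([]=⇒lookup; lookup-replicate)
open import Data.Bool using (true; false; if_then_else_)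
open import Data.List using (List; []; _∷_; map)
open import Data.Product using (∃-syntax; _,_)
open import Data.Sum using (inj₁)
open import Data.Unit using (tt)
open import Data.Empty using (⊥-elim)
open import Relation.Binary.PropositionalEquality using (_≡_; _≢_; refl; sym; trans; cong; cong₂)

total⇒StrictImpl : ∀ {k} {𝓕 : PredSet k} {m} {g : Predicate k m}
  (cs : List (Constraint 𝓕 m 0)) → (∀ y z → total cs y z ≡ g y) → ∃[ y ] g y ≢ 0 →
  StrictImpl 𝓕 g 1
total⇒StrictImpl [] total≡g (y , gy≢0) = ⊥-elim (gy≢0 (sym (total≡g y (λ ()))))
total⇒StrictImpl {g = g} (c ∷ cs) total≡g _ =
  0 , c ∷ cs , tt , λ y →
    g y , (((λ ()) , total≡g y (λ ())) , (λ z → ≤-reflexive (total≡g y z))) , refl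

indicator : ∀ {k} → Subset k → Fin k → ℕ
indicator p x = if lookup p x then 1 else 0

members : ∀ {k} → Subset k → List (Fin k)
members []          = []
members (true ∷ p)  = zero ∷ map suc (members p)
members (false ∷ p) = map suc (members p)

occurrences : ∀ {k} → List (Fin k) → Fin k → ℕ
occurrences l x = sum (map (λ d → indicator ⁅ d ⁆ x) l)

indicator-⁅zero⁆-suc : ∀ {k} (x : Fin k) → indicator ⁅ zero ⁆ (suc x) ≡ 0
indicator-⁅zero⁆-suc x = cong (λ b → if b then 1 else 0) (lookup-replicate x false)

occurrences-map-suc-zero : ∀ {k} (l : List (Fin k)) → occurrences (map suc l) zero ≡ 0
occurrences-map-suc-zero []      = refl
occurrences-map-suc-zero (_ ∷ l) = occurrences-map-suc-zero l

occurrences-map-suc : ∀ {k} (l : List (Fin k)) (x : Fin k) →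
  occurrences (map suc l) (suc x) ≡ occurrences l x
occurrences-map-suc []      x = refl
occurrences-map-suc (d ∷ l) x = cong (indicator ⁅ d ⁆ x +_) (occurrences-map-suc l x)

occurrences-members : ∀ {k} (p : Subset k) (x : Fin k) →
  occurrences (members p) x ≡ indicator p x
occurrences-members (true ∷ p)  zero    = cong suc (occurrences-map-suc-zero (members p))
occurrences-members (true ∷ p)  (suc x) =
  cong₂ _+_ (indicator-⁅zero⁆-suc x)
            (trans (occurrences-map-suc (members p) x) (occurrences-members p x))
occurrences-members (false ∷ p) zero    = occurrences-map-suc-zero (members p)
occurrences-members (false ∷ p) (suc x) =
  trans (occurrences-map-suc (members p) x) (occurrences-members p x)

singletonAt : ∀ {k m n} → Fin k → Fin m → Constraint (𝒞 k) m n
singletonAt d i = record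
  { arity = 1 ; pred = u ⁅ d ⁆ ; inF = const d (u ⁅ d ⁆) (λ _ → refl) ; args = λ _ → inj₁ i }

total-singletonAt : ∀ {k m n} (l : List (Fin k)) (i : Fin m) y z →
  total (map (λ d → singletonAt {n = n} d i) l) y z ≡ occurrences l (y i)
total-singletonAt []      i y z = refl
total-singletonAt (d ∷ l) i y z = cong (indicator ⁅ d ⁆ (y i) +_) (total-singletonAt l i y z)

lemma3p2 : (k : ℕ) → 2 ≤ k → (D' : Subset k) → 𝒰 k D' →
    StrictlyImplements (𝒞 k) (u D')
lemma3p2 k _ D' (x , x∈D') =
  1 , total⇒StrictImpl (map (λ d → singletonAt d zero) (members D')) total≡u ((λ _ → x) , u≢0)
  where
    total≡u : ∀ y z → total (map (λ d → singletonAt d zero) (members D')) y z ≡ u D' y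
    total≡u y z = trans (total-singletonAt (members D') zero y z) (occurrences-members D' (y zero))

    u≢0 : u D' (λ _ → x) ≢ 0
    u≢0 rewrite []=⇒lookup x∈D' = λ ()
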